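{- Let $n,k,A$ be positive integers. Then a uniform random $k$-multiset permutation $S_{k;n}$ of size $n$ and a uniform random $kA$-multiset permutation $\widetilde S_{kA;\lfloor n/A\rfloor}$ of size $\lfloor n/A\rfloor$ can be built on the same probability space in such a way that $$\mathcal{L}_\leq(S_{k;n})\leq\mathcal{L}_\leq(\widetilde S_{kA;\lfloor n/A\rfloor})+kA.$$
   Context: For positive integers $k$ and $m\geq0$, a $k$-multiset permutation of size $m$ is a word $s=(s(1),\dots,s(km))$ over $\{1,\dots,m\}$ in which each letter appears exactly $k$ times (the empty word if $m=0$), identified with the point set $\{(i,s(i))\}$. For a finite point set $\mathcal{P}$, $\mathcal{L}_\leq(\mathcal{P})$ is the largest $L$ such that there exist $P_1,\dots,P_L\in\mathcal{P}$, $P_j=(a_j,b_j)$, with $a_j<a_{j+1}$ and $b_j\leq b_{j+1}$ for all $j$ (length of the longest non-decreasing subsequence). -}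

module Defs where

open import Data.Nat as ℕ using (ℕ; zero; suc; _⊔_; _≤ᵇ_)
open import Data.Fin as Fin using (Fin; toℕ)
open import Data.Fin.Properties using (all?)
open import Data.Vec as Vec using (Vec; []; _∷_; toList)
open import Data.List as List using (List; []; _∷_; length; filter; map; concatMap; allFin; foldr)
open import Data.Bool using (Bool; true; false; _∧_)
open import Data.Integer using (+_)
open import Data.Rational as ℚ using (ℚ; 0ℚ)
open import Relation.Binary.PropositionalEquality using (_≡_)
open import Relation.Nullary using (Dec)
import Data.Nat.Properties as ℕP
open import Data.List.Membership.Propositional using (_∈_)

count : {m : ℕ} → Fin m → List (Fin m) → ℕ
count i xs = length (filter (λ x → x Fin.≟ i) xs)

-- words of length l over the alphabet {1..m} (encoded as Fin m)
Word : ℕ → ℕ → Set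
Word m l = Vec (Fin m) l

IsMultisetPerm : (k m : ℕ) → Word m (k ℕ.* m) → Set
IsMultisetPerm k m s = (i : Fin m) → count i (toList s) ≡ k

isMultisetPerm? : (k m : ℕ) → (s : Word m (k ℕ.* m)) → Dec (IsMultisetPerm k m s)
isMultisetPerm? k m s = all? (λ i → count i (toList s) ℕP.≟ k)

allWords : (m l : ℕ) → List (Word m l)
allWords m zero = [] ∷ []
allWords m (suc l) = concatMap (λ i → map (i ∷_) (allWords m l)) (allFin m)

multisetPerms : (k m : ℕ) → List (Word m (k ℕ.* m))
multisetPerms k m = filter (isMultisetPerm? k m) (allWords m (k ℕ.* m))

subseqs : {A : Set} → List A → List (List A)
subseqs [] = [] ∷ []
subseqs (x ∷ xs) = map (x ∷_) (subseqs xs) List.++ subseqs xs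

nonDecr : {m : ℕ} → List (Fin m) → Bool
nonDecr [] = true
nonDecr (x ∷ []) = true
nonDecr (x ∷ y ∷ ys) = (toℕ x ≤ᵇ toℕ y) ∧ nonDecr (y ∷ ys)

-- L_≤ : length of a longest non-decreasing subsequence of the word
-- (points (i, s(i)), strictly increasing positions, non-decreasing values)
Lnd : {m l : ℕ} → Word m l → ℕ
Lnd s = foldr _⊔_ 0 (map length (filter (λ xs → Data.Bool._≟_ (nonDecr xs) true) (subseqs (toList s))))
  where import Data.Bool

Σℚ : {A : Set} → List A → (A → ℚ) → ℚ
Σℚ xs f = foldr ℚ._+_ 0ℚ (map f xs)

ℕtoℚ : ℕ → ℚ
ℕtoℚ n = (+ n) ℚ./ 1

-- A coupling of the uniform distribution on the finite set X (list without
-- repetitions) and the uniform distribution on Y, supported on pairs satisfying R: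
-- a joint probability mass function w on X × Y with uniform marginals.
record UniformCoupling {X Y : Set} (xs : List X) (ys : List Y) (R : X → Y → Set) : Set where
  field
    w        : X → Y → ℚ
    nonneg   : ∀ x y → 0ℚ ℚ.≤ w x y
    margin₁  : ∀ x → x ∈ xs → ℕtoℚ (length xs) ℚ.* Σℚ ys (w x) ≡ ℚ.1ℚ
    margin₂  : ∀ y → y ∈ ys → ℕtoℚ (length ys) ℚ.* Σℚ xs (λ x → w x y) ≡ ℚ.1ℚ
    support  : ∀ x y → x ∈ xs → y ∈ ys → 0ℚ ℚ.< w x y → R x y

-- Map a word over {0,…,n-1} to one over {0,…,⌊n/A⌋-1} by sending the letter x to its block
-- ⌊x/A⌋ and dropping the letters of the incomplete last block. Every complete block has A letters,
-- each occurring k times, so a k-multiset permutation is sent to a kA-multiset permutation. The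
-- map is monotone, so the image of a non-decreasing subsequence is non-decreasing and only the
-- dropped letters are lost; there are k (n mod A) < kA of them. Exchanging two adjacent kept
-- letters of a word (dropped letters staying in place) is an involution of the k-multiset
-- permutations acting on images as an adjacent transposition, so all kA-multiset permutations have
-- equally many preimages. Hence the coupling of a uniform S with its image has uniform marginals.

module Submission where

open import Defs

open import Data.Bool using (true; false; if_then_else_)
import Data.Bool.Properties as Bool
open import Data.Empty using (⊥; ⊥-elim)
open import Data.Fin as Fin using (Fin; toℕ; fromℕ<)
import Data.Fin.Properties as Fin
open import Data.Integer as ℤ using (1ℤ)
import Data.Integer.Properties as ℤ
open import Data.List as List using (List; []; _∷_; [_]; _++_; length; filter; map; mapMaybe; foldr; replicate; concatMap; allFin; upTo)
import Data.List.Properties as List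
open import Data.List.Membership.Propositional using (_∈_)
open import Data.List.Membership.Propositional.Properties
open import Data.List.Membership.Propositional.Properties.WithK using (unique∧set⇒bag)
open import Data.List.Relation.Binary.BagAndSetEquality using (∼bag⇒↭)
open import Data.List.Relation.Binary.Permutation.Propositional as ↭ using (_↭_; ↭-refl; ↭-sym; ↭-trans; prep; swap)
import Data.List.Relation.Binary.Permutation.Propositional.Properties as ↭
open import Data.List.Relation.Unary.All as All using (All; []; _∷_)
open import Data.List.Relation.Unary.AllPairs using ([]; _∷_)
open import Data.List.Relation.Unary.Any using (Any; here; there)
open import Data.List.Relation.Unary.Unique.Propositional using (Unique)
import Data.List.Relation.Unary.Unique.Propositional.Properties as Unique
open import Data.Maybe as Maybe using (Maybe; just; nothing; maybe′)
import Data.Maybe.Properties as Maybe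
open import Data.Nat as ℕ using (ℕ; zero; suc; _+_; _*_; _∸_; _/_; _%_; _≤_; _<_; _⊔_; z≤n; NonZero)
import Data.Nat.Properties as ℕ
open import Data.Nat.Coprimality using (gcd≡1⇒coprime)
open import Data.Nat.DivMod using (m≡m%n+[m/n]*n; m%n<n; m<n*o⇒m/o<n; m*n/n≡m; /-monoˡ-≤; m/n*n≤m)
open import Data.Nat.GCD using (gcd-zeroʳ)
open import Data.Nat.ListAction using (sum)
open import Data.Product using (∃; _×_; _,_; proj₂; uncurry; map₂)
open import Data.Rational as ℚ using (ℚ; mkℚ; 0ℚ; 1ℚ; 1/_)
import Data.Rational.Properties as ℚ
import Data.Rational.Unnormalised as ℚᵘ
import Data.Rational.Unnormalised.Properties as ℚᵘ
open import Data.Sum using (inj₁; inj₂)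
open import Data.Vec as Vec using (Vec; toList; fromList)
import Data.Vec.Properties as Vec
open import Function using (_∘_; id; mk⇔; Equivalence)
open import Relation.Binary.Definitions using (DecidableEquality)
open import Relation.Binary.PropositionalEquality hiding ([_])
open import Relation.Nullary using (Dec; yes; no; does; ¬_; contradiction)
open import Relation.Unary using (Decidable)

open import Algebra.Properties.CommutativeSemigroup ℕ.+-commutativeSemigroup using (interchange)

private
  variable
    X Y Z C : Set

indicator : {P : Set} → Dec P → ℕ
indicator d = if does d then 1 else 0

countBy : {P : X → Set} → Decidable P → List X → ℕ
countBy P? xs = length (filter P? xs)

module _ {P : X → Set} (P? : Decidable P) where

  countBy-∷ : ∀ x xs → countBy P? (x ∷ xs) ≡ indicator (P? x) + countBy P? xs
  countBy-∷ x xs with P? x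
  ... | yes _ = refl
  ... | no _  = refl

  countBy-++ : ∀ xs ys → countBy P? (xs ++ ys) ≡ countBy P? xs + countBy P? ys
  countBy-++ xs ys = trans (cong length (List.filter-++ P? xs ys)) (List.length-++ (filter P? xs))

  countBy-↭ : ∀ {xs ys} → xs ↭ ys → countBy P? xs ≡ countBy P? ys
  countBy-↭ p = ↭.↭-length (↭.filter-↭ P? p)

  countBy-none : ∀ {xs} → All (¬_ ∘ P) xs → countBy P? xs ≡ 0
  countBy-none ¬ps = cong length (List.filter-none P? ¬ps)

  countBy-unique : ∀ {xs x} → Unique xs → x ∈ xs → P x → (∀ {y} → y ∈ xs → P y → y ≡ x) →
                   countBy P? xs ≡ 1
  countBy-unique {x ∷ xs} (x∉ ∷ _) (here refl) px only =
    trans (cong length (List.filter-accept P? px))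
          (cong suc (countBy-none (All.tabulate λ y∈ py → All.lookup x∉ y∈ (sym (only (there y∈) py)))))
  countBy-unique {y ∷ xs} (y∉ ∷ u) (there x∈) px only =
    trans (cong length (List.filter-reject P? ¬py)) (countBy-unique u x∈ px (only ∘ there))
    where
    ¬py : ¬ P y
    ¬py py = All.lookup y∉ x∈ (only (here refl) py)

  countBy-suc⇒∈ : ∀ xs {m} → countBy P? xs ≡ suc m → ∃ λ y → y ∈ xs × P y
  countBy-suc⇒∈ (x ∷ xs) eq with P? x
  ... | yes px = x , here refl , px
  ... | no _ with countBy-suc⇒∈ xs eq
  ...   | y , y∈ , py = y , there y∈ , py

  countBy-replicate : ∀ m x → countBy P? (replicate m x) ≡ m * indicator (P? x)
  countBy-replicate zero    x = refl
  countBy-replicate (suc m) x = trans (countBy-∷ x (replicate m x)) (cong (indicator (P? x) +_) (countBy-replicate m x))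

  countBy-replicateEach : ∀ m xs → countBy P? (concatMap (replicate m) xs) ≡ m * countBy P? xs
  countBy-replicateEach m []       = sym (ℕ.*-zeroʳ m)
  countBy-replicateEach m (x ∷ xs) = begin
    countBy P? (replicate m x ++ concatMap (replicate m) xs)  ≡⟨ countBy-++ (replicate m x) _ ⟩
    countBy P? (replicate m x) + countBy P? (concatMap (replicate m) xs)
      ≡⟨ cong₂ _+_ (countBy-replicate m x) (countBy-replicateEach m xs) ⟩
    m * indicator (P? x) + m * countBy P? xs                  ≡⟨ ℕ.*-distribˡ-+ m _ _ ⟨
    m * (indicator (P? x) + countBy P? xs)                    ≡⟨ cong (m *_) (countBy-∷ x xs) ⟨
    m * countBy P? (x ∷ xs)                                   ∎
    where open ≡-Reasoning

countBy-cong : ∀ {P Q : X → Set} (P? : Decidable P) (Q? : Decidable Q) {xs} →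
               (∀ {x} → x ∈ xs → P x → Q x) → (∀ {x} → x ∈ xs → Q x → P x) →
               countBy P? xs ≡ countBy Q? xs
countBy-cong P? Q? {[]}     _ _ = refl
countBy-cong P? Q? {x ∷ xs} P⇒Q Q⇒P with P? x | Q? x | countBy-cong P? Q? (P⇒Q ∘ there) (Q⇒P ∘ there)
... | yes _  | yes _  | eq = cong suc eq
... | no _   | no _   | eq = eq
... | yes px | no ¬qx | _  = ⊥-elim (¬qx (P⇒Q (here refl) px))
... | no ¬px | yes qx | _  = ⊥-elim (¬px (Q⇒P (here refl) qx))

countBy-map : ∀ {P : Y → Set} (P? : Decidable P) (f : X → Y) xs → countBy P? (map f xs) ≡ countBy (P? ∘ f) xs
countBy-map P? f []       = refl
countBy-map P? f (x ∷ xs) with P? (f x)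
... | yes _ = cong suc (countBy-map P? f xs)
... | no _  = countBy-map P? f xs

module _ (_≟_ : DecidableEquality X) where

  countBy-≟-∷-self : ∀ x xs → countBy (_≟ x) (x ∷ xs) ≡ suc (countBy (_≟ x) xs)
  countBy-≟-∷-self x xs = cong length (List.filter-accept (_≟ x) refl)

  countBy-≡⇒↭ : ∀ xs ys → (∀ z → countBy (_≟ z) xs ≡ countBy (_≟ z) ys) → xs ↭ ys
  countBy-≡⇒↭ []       []       _    = ↭-refl
  countBy-≡⇒↭ []       (y ∷ ys) same = contradiction (trans (same y) (countBy-≟-∷-self y ys)) ℕ.0≢1+n
  countBy-≡⇒↭ (x ∷ xs) ys       same
    with countBy-suc⇒∈ (_≟ x) ys (trans (sym (same x)) (countBy-≟-∷-self x xs))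
  ... | _ , x∈ys , refl with ∈-∃++ x∈ys
  ...   | pre , post , refl = ↭-trans (prep x (countBy-≡⇒↭ xs (pre ++ post) same′)) (↭-sym (↭.shift x pre post))
    where
    same′ : ∀ z → countBy (_≟ z) xs ≡ countBy (_≟ z) (pre ++ post)
    same′ z = ℕ.+-cancelˡ-≡ (indicator (x ≟ z)) _ _ (begin
      indicator (x ≟ z) + countBy (_≟ z) xs             ≡⟨ countBy-∷ (_≟ z) x xs ⟨
      countBy (_≟ z) (x ∷ xs)                           ≡⟨ same z ⟩
      countBy (_≟ z) (pre ++ x ∷ post)                  ≡⟨ countBy-↭ (_≟ z) (↭.shift x pre post) ⟩
      countBy (_≟ z) (x ∷ pre ++ post)                  ≡⟨ countBy-∷ (_≟ z) x (pre ++ post) ⟩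
      indicator (x ≟ z) + countBy (_≟ z) (pre ++ post)  ∎)
      where open ≡-Reasoning

sum-map-const : ∀ (f : X → ℕ) c {xs} → (∀ {x} → x ∈ xs → f x ≡ c) → sum (map f xs) ≡ length xs * c
sum-map-const f c {[]}     _     = refl
sum-map-const f c {x ∷ xs} const = cong₂ _+_ (const (here refl)) (sum-map-const f c (const ∘ there))

sum-map-+ : ∀ (f g : X → ℕ) xs → sum (map (λ x → f x + g x) xs) ≡ sum (map f xs) + sum (map g xs)
sum-map-+ f g []       = refl
sum-map-+ f g (x ∷ xs) = trans (cong (f x + g x +_) (sum-map-+ f g xs)) (interchange (f x) (g x) _ _)

sum-map-indicator : ∀ {P : X → Set} (P? : Decidable P) xs → sum (map (indicator ∘ P?) xs) ≡ countBy P? xs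
sum-map-indicator P? []       = refl
sum-map-indicator P? (x ∷ xs) = trans (cong (indicator (P? x) +_) (sum-map-indicator P? xs)) (sym (countBy-∷ P? x xs))

sum-countBy-comm : ∀ {R : X → Y → Set} (R? : ∀ x y → Dec (R x y)) xs ys →
                   sum (map (λ y → countBy (λ x → R? x y) xs) ys) ≡ sum (map (λ x → countBy (R? x) ys) xs)
sum-countBy-comm R? []       ys = trans (sum-map-const _ 0 {ys} (λ _ → refl)) (ℕ.*-zeroʳ (length ys))
sum-countBy-comm R? (x ∷ xs) ys = begin
  sum (map (λ y → countBy (λ x′ → R? x′ y) (x ∷ xs)) ys)
    ≡⟨ cong sum (List.map-cong (λ y → countBy-∷ (λ x′ → R? x′ y) x xs) ys) ⟩
  sum (map (λ y → indicator (R? x y) + countBy (λ x′ → R? x′ y) xs) ys)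
    ≡⟨ sum-map-+ (indicator ∘ R? x) _ ys ⟩
  sum (map (indicator ∘ R? x) ys) + sum (map (λ y → countBy (λ x′ → R? x′ y) xs) ys)
    ≡⟨ cong₂ _+_ (sum-map-indicator (R? x) ys) (sum-countBy-comm R? xs ys) ⟩
  countBy (R? x) ys + sum (map (λ x′ → countBy (R? x′) ys) xs) ∎
  where open ≡-Reasoning

ℕtoℚ-nf : ℕ → ℚ
ℕtoℚ-nf n = mkℚ (ℤ.+ n) 0 (gcd≡1⇒coprime (gcd-zeroʳ n))

ℕtoℚ≡ℕtoℚ-nf : ∀ n → ℕtoℚ n ≡ ℕtoℚ-nf n
ℕtoℚ≡ℕtoℚ-nf n = ℚ.↥p/↧p≡p (ℕtoℚ-nf n)

ℕtoℚ-+ : ∀ a b → ℕtoℚ (a + b) ≡ ℕtoℚ a ℚ.+ ℕtoℚ b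
ℕtoℚ-+ a b rewrite ℕtoℚ≡ℕtoℚ-nf (a + b) | ℕtoℚ≡ℕtoℚ-nf a | ℕtoℚ≡ℕtoℚ-nf b =
  ℚ.toℚᵘ-injective (ℚᵘ.≃-sym (ℚᵘ.≃-trans (ℚ.toℚᵘ-homo-+ (ℕtoℚ-nf a) (ℕtoℚ-nf b)) (ℚᵘ.*≡* cross-multiplied)))
  where
  cross-multiplied : (ℤ.+ a ℤ.* 1ℤ ℤ.+ ℤ.+ b ℤ.* 1ℤ) ℤ.* 1ℤ ≡ ℤ.+ (a + b) ℤ.* (1ℤ ℤ.* 1ℤ)
  cross-multiplied rewrite ℤ.*-identityʳ (ℤ.+ a) | ℤ.*-identityʳ (ℤ.+ b) | ℤ.*-identityʳ (ℤ.+ a ℤ.+ ℤ.+ b) = refl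

ℕtoℚ-suc : ∀ n → ℕtoℚ (suc n) ≡ 1ℚ ℚ.+ ℕtoℚ n
ℕtoℚ-suc = ℕtoℚ-+ 1

ℕtoℚ-suc-* : ∀ m c → ℕtoℚ (suc m) ℚ.* c ≡ c ℚ.+ ℕtoℚ m ℚ.* c
ℕtoℚ-suc-* m c = begin
  ℕtoℚ (suc m) ℚ.* c              ≡⟨ cong (ℚ._* c) (ℕtoℚ-suc m) ⟩
  (1ℚ ℚ.+ ℕtoℚ m) ℚ.* c           ≡⟨ ℚ.*-distribʳ-+ c 1ℚ (ℕtoℚ m) ⟩
  1ℚ ℚ.* c ℚ.+ ℕtoℚ m ℚ.* c       ≡⟨ cong (ℚ._+ ℕtoℚ m ℚ.* c) (ℚ.*-identityˡ c) ⟩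
  c ℚ.+ ℕtoℚ m ℚ.* c              ∎
  where open ≡-Reasoning

ℕtoℚ-* : ∀ a b → ℕtoℚ (a * b) ≡ ℕtoℚ a ℚ.* ℕtoℚ b
ℕtoℚ-* zero    b = sym (ℚ.*-zeroˡ (ℕtoℚ b))
ℕtoℚ-* (suc a) b = begin
  ℕtoℚ (b + a * b)                ≡⟨ ℕtoℚ-+ b (a * b) ⟩
  ℕtoℚ b ℚ.+ ℕtoℚ (a * b)         ≡⟨ cong (ℕtoℚ b ℚ.+_) (ℕtoℚ-* a b) ⟩
  ℕtoℚ b ℚ.+ ℕtoℚ a ℚ.* ℕtoℚ b    ≡⟨ ℕtoℚ-suc-* a (ℕtoℚ b) ⟨
  ℕtoℚ (suc a) ℚ.* ℕtoℚ b         ∎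
  where open ≡-Reasoning

-- 1/n, with the junk value 0 at n = 0.
recip : ℕ → ℚ
recip zero    = 0ℚ
recip (suc n) = 1/ ℕtoℚ-nf (suc n)

recip-nonneg : ∀ n → 0ℚ ℚ.≤ recip n
recip-nonneg zero    = ℚ.≤-refl
recip-nonneg (suc n) = ℚ.nonNegative⁻¹ (recip (suc n))

ℕtoℚ-*-recip : ∀ n .{{_ : NonZero n}} → ℕtoℚ n ℚ.* recip n ≡ 1ℚ
ℕtoℚ-*-recip (suc n) rewrite ℕtoℚ≡ℕtoℚ-nf (suc n) = ℚ.*-inverseʳ (ℕtoℚ-nf (suc n))

ℕtoℚ-*-recip-of-product : ∀ a b n .{{_ : NonZero n}} → a * b ≡ n → ℕtoℚ a ℚ.* (ℕtoℚ b ℚ.* recip n) ≡ 1ℚ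
ℕtoℚ-*-recip-of-product a b n refl = begin
  ℕtoℚ a ℚ.* (ℕtoℚ b ℚ.* recip n)  ≡⟨ ℚ.*-assoc (ℕtoℚ a) (ℕtoℚ b) (recip n) ⟨
  ℕtoℚ a ℚ.* ℕtoℚ b ℚ.* recip n    ≡⟨ cong (ℚ._* recip n) (ℕtoℚ-* a b) ⟨
  ℕtoℚ (a * b) ℚ.* recip n         ≡⟨ ℕtoℚ-*-recip n ⟩
  1ℚ                               ∎
  where open ≡-Reasoning

Σℚ-if-does : ∀ {P : X → Set} (P? : Decidable P) c xs →
             Σℚ xs (λ x → if does (P? x) then c else 0ℚ) ≡ ℕtoℚ (countBy P? xs) ℚ.* c
Σℚ-if-does P? c []       = sym (ℚ.*-zeroˡ c)
Σℚ-if-does P? c (x ∷ xs) with P? x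
... | yes _ = trans (cong (c ℚ.+_) (Σℚ-if-does P? c xs)) (sym (ℕtoℚ-suc-* (countBy P? xs) c))
... | no _  = trans (ℚ.+-identityˡ _) (Σℚ-if-does P? c xs)

module _ {_↦_ : X → Y → Set} (_↦?_ : ∀ x y → Dec (x ↦ y)) {xs : List X} {ys : List Y} where

  fibreSize : Y → ℕ
  fibreSize y = countBy (_↦? y) xs

  length-*-fibreSize : (∀ {x} → x ∈ xs → countBy (x ↦?_) ys ≡ 1) →
                       (∀ {y y′} → y ∈ ys → y′ ∈ ys → fibreSize y ≡ fibreSize y′) →
                       ∀ {y} → y ∈ ys → length ys * fibreSize y ≡ length xs
  length-*-fibreSize functional constant {y} y∈ = begin
    length ys * fibreSize y                  ≡⟨ sum-map-const fibreSize (fibreSize y) (λ y′∈ → constant y′∈ y∈) ⟨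
    sum (map fibreSize ys)                   ≡⟨ sum-countBy-comm _↦?_ xs ys ⟩
    sum (map (λ x → countBy (x ↦?_) ys) xs)  ≡⟨ sum-map-const _ 1 functional ⟩
    length xs * 1                            ≡⟨ ℕ.*-identityʳ (length xs) ⟩
    length xs                                ∎
    where open ≡-Reasoning

  uniformCoupling-fromGraph : {R : X → Y → Set} → NonZero (length xs) →
                              (∀ {x} → x ∈ xs → countBy (x ↦?_) ys ≡ 1) →
                              (∀ {y y′} → y ∈ ys → y′ ∈ ys → fibreSize y ≡ fibreSize y′) →
                              (∀ {x y} → x ∈ xs → x ↦ y → R x y) →
                              UniformCoupling xs ys R
  uniformCoupling-fromGraph {R} nonempty functional constant graph⊆R = record
    { w       = w
    ; nonneg  = nonneg
    ; margin₁ = margin₁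
    ; margin₂ = margin₂
    ; support = support
    }
    where
    open ≡-Reasoning
    c : ℚ
    c = recip (length xs)

    w : X → Y → ℚ
    w x y = if does (x ↦? y) then c else 0ℚ

    nonneg : ∀ x y → 0ℚ ℚ.≤ w x y
    nonneg x y with does (x ↦? y)
    ... | true  = recip-nonneg (length xs)
    ... | false = ℚ.≤-refl

    margin₁ : ∀ x → x ∈ xs → ℕtoℚ (length xs) ℚ.* Σℚ ys (w x) ≡ 1ℚ
    margin₁ x x∈ = begin
      ℕtoℚ (length xs) ℚ.* Σℚ ys (w x)
        ≡⟨ cong (ℕtoℚ (length xs) ℚ.*_) (Σℚ-if-does (x ↦?_) c ys) ⟩
      ℕtoℚ (length xs) ℚ.* (ℕtoℚ (countBy (x ↦?_) ys) ℚ.* c)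
        ≡⟨ ℕtoℚ-*-recip-of-product (length xs) _ (length xs) {{nonempty}}
             (trans (cong (length xs *_) (functional x∈)) (ℕ.*-identityʳ (length xs))) ⟩
      1ℚ ∎

    margin₂ : ∀ y → y ∈ ys → ℕtoℚ (length ys) ℚ.* Σℚ xs (λ x → w x y) ≡ 1ℚ
    margin₂ y y∈ = begin
      ℕtoℚ (length ys) ℚ.* Σℚ xs (λ x → w x y)
        ≡⟨ cong (ℕtoℚ (length ys) ℚ.*_) (Σℚ-if-does (_↦? y) c xs) ⟩
      ℕtoℚ (length ys) ℚ.* (ℕtoℚ (fibreSize y) ℚ.* c)
        ≡⟨ ℕtoℚ-*-recip-of-product (length ys) _ (length xs) {{nonempty}} (length-*-fibreSize functional constant y∈) ⟩
      1ℚ ∎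

    support : ∀ x y → x ∈ xs → y ∈ ys → 0ℚ ℚ.< w x y → R x y
    support x y x∈ _ w>0 with x ↦? y
    ... | yes x↦y = graph⊆R x∈ x↦y
    ... | no _    = contradiction w>0 (ℚ.<-irrefl refl)

∃-Vec-toList : ∀ {l} (xs : List X) → length xs ≡ l → ∃ λ (v : Vec X l) → toList v ≡ xs
∃-Vec-toList xs refl = fromList xs , Vec.toList∘fromList xs

∈-allWords : ∀ m l (v : Word m l) → v ∈ allWords m l
∈-allWords m zero    Vec.[]       = here refl
∈-allWords m (suc l) (x Vec.∷ v) =
  ∈-concatMap⁺ (λ i → map (i Vec.∷_) (allWords m l)) (lift (∈-allFin x))
  where
  lift : ∀ {is} → x ∈ is → Any (λ i → x Vec.∷ v ∈ map (i Vec.∷_) (allWords m l)) is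
  lift (here refl) = here (∈-map⁺ (x Vec.∷_) (∈-allWords m l v))
  lift (there x∈)  = there (lift x∈)

allWords-unique : ∀ m l → Unique (allWords m l)
allWords-unique m zero    = [] ∷ []
allWords-unique m (suc l) = prefixed (allFin m) (Unique.allFin⁺ m)
  where
  W : List (Word m l)
  W = allWords m l
  prefixed : ∀ is → Unique is → Unique (concatMap (λ i → map (i Vec.∷_) W) is)
  prefixed []       _           = []
  prefixed (i ∷ is) (i∉ ∷ uis) = Unique.++⁺ (Unique.map⁺ Vec.∷-injectiveʳ (allWords-unique m l)) (prefixed is uis) disjoint
    where
    disjoint : ∀ {v} → ¬ (v ∈ map (i Vec.∷_) W × v ∈ concatMap (λ j → map (j Vec.∷_) W) is)
    disjoint (v∈ , v∈′) with ∈-map⁻ (i Vec.∷_) v∈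
    ... | w , _ , refl = other-head is i∉ (∈-concatMap⁻ (λ j → map (j Vec.∷_) W) {xs = is} v∈′)
      where
      other-head : ∀ js → All (i ≢_) js → Any (λ j → i Vec.∷ w ∈ map (j Vec.∷_) W) js → ⊥
      other-head (j ∷ js) (i≢j ∷ _) (here w∈) with ∈-map⁻ (j Vec.∷_) w∈
      ... | _ , _ , refl = i≢j refl
      other-head (j ∷ js) (_ ∷ i∉js) (there w∈) = other-head js i∉js w∈

module _ {k m : ℕ} where

  multisetPerms-unique : Unique (multisetPerms k m)
  multisetPerms-unique = Unique.filter⁺ (isMultisetPerm? k m) (allWords-unique m (k * m))

  ∈-multisetPerms⁻ : ∀ {s} → s ∈ multisetPerms k m → IsMultisetPerm k m s
  ∈-multisetPerms⁻ = proj₂ ∘ ∈-filter⁻ (isMultisetPerm? k m) {xs = allWords m (k * m)}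

  ∈-multisetPerms⁺ : ∀ {s} → IsMultisetPerm k m s → s ∈ multisetPerms k m
  ∈-multisetPerms⁺ {s} = ∈-filter⁺ (isMultisetPerm? k m) (∈-allWords m (k * m) s)

  multisetPerms-↭ : ∀ {s s′} → s ∈ multisetPerms k m → s′ ∈ multisetPerms k m → toList s ↭ toList s′
  multisetPerms-↭ s∈ s′∈ =
    countBy-≡⇒↭ Fin._≟_ _ _ λ j → trans (∈-multisetPerms⁻ s∈ j) (sym (∈-multisetPerms⁻ s′∈ j))

  multisetPerms-closed-↭ : ∀ {s s′} → s ∈ multisetPerms k m → toList s ↭ toList s′ → s′ ∈ multisetPerms k m
  multisetPerms-closed-↭ s∈ s↭s′ =
    ∈-multisetPerms⁺ λ j → trans (sym (countBy-↭ (Fin._≟ j) s↭s′)) (∈-multisetPerms⁻ s∈ j)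

length≡sum-count : ∀ {m} (u : List (Fin m)) → length u ≡ sum (map (λ j → count j u) (allFin m))
length≡sum-count {m} u = sym (begin
  sum (map (λ j → countBy (Fin._≟ j) u) (allFin m))   ≡⟨ sum-countBy-comm Fin._≟_ u (allFin m) ⟩
  sum (map (λ x → countBy (x Fin.≟_) (allFin m)) u)   ≡⟨ sum-map-const _ 1 {u} (λ _ → count-allFin) ⟩
  length u * 1                                        ≡⟨ ℕ.*-identityʳ (length u) ⟩
  length u                                            ∎)
  where
  open ≡-Reasoning
  count-allFin : ∀ {x} → countBy (x Fin.≟_) (allFin m) ≡ 1
  count-allFin {x} = countBy-unique (x Fin.≟_) (Unique.allFin⁺ m) (∈-allFin x) refl (λ _ → sym)

module _ (k m : ℕ) where

  sortedMultisetPerm : List (Fin m)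
  sortedMultisetPerm = concatMap (replicate k) (allFin m)

  count-sortedMultisetPerm : ∀ j → count j sortedMultisetPerm ≡ k
  count-sortedMultisetPerm j = begin
    countBy (Fin._≟ j) sortedMultisetPerm  ≡⟨ countBy-replicateEach (Fin._≟ j) k (allFin m) ⟩
    k * countBy (Fin._≟ j) (allFin m)      ≡⟨ cong (k *_) (countBy-unique (Fin._≟ j) (Unique.allFin⁺ m) (∈-allFin j) refl (λ _ → id)) ⟩
    k * 1                                  ≡⟨ ℕ.*-identityʳ k ⟩
    k                                      ∎
    where open ≡-Reasoning

  length-sortedMultisetPerm : length sortedMultisetPerm ≡ k * m
  length-sortedMultisetPerm = begin
    length sortedMultisetPerm                                   ≡⟨ length≡sum-count sortedMultisetPerm ⟩
    sum (map (λ j → count j sortedMultisetPerm) (allFin m))     ≡⟨ sum-map-const _ k {allFin m} (λ {j} _ → count-sortedMultisetPerm j) ⟩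
    length (allFin m) * k                                       ≡⟨ cong (_* k) (List.length-tabulate {n = m} id) ⟩
    m * k                                                       ≡⟨ ℕ.*-comm m k ⟩
    k * m                                                       ∎
    where open ≡-Reasoning

  multisetPerms-nonempty : NonZero (length (multisetPerms k m))
  multisetPerms-nonempty with ∃-Vec-toList sortedMultisetPerm length-sortedMultisetPerm
  ... | s , toList-s = nonEmpty (∈-multisetPerms⁺ λ j → trans (cong (count j) toList-s) (count-sortedMultisetPerm j))
    where
    nonEmpty : ∀ {xs : List (Word m (k * m))} → s ∈ xs → NonZero (length xs)
    nonEmpty (here _)  = _
    nonEmpty (there _) = _

  countBy-multisetPerm : ∀ {P : Fin m → Set} (P? : Decidable P) {s} → s ∈ multisetPerms k m →
                         countBy P? (toList s) ≡ k * countBy P? (allFin m)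
  countBy-multisetPerm P? {s} s∈ =
    trans (countBy-↭ P? (countBy-≡⇒↭ Fin._≟_ (toList s) sortedMultisetPerm same)) (countBy-replicateEach P? k (allFin m))
    where
    same : ∀ j → count j (toList s) ≡ count j sortedMultisetPerm
    same j = trans (∈-multisetPerms⁻ s∈ j) (sym (count-sortedMultisetPerm j))

module _ {m : ℕ} where

  NonDecr : List (Fin m) → Set
  NonDecr xs = nonDecr xs ≡ true

  nonDecr? : Decidable NonDecr
  nonDecr? xs = nonDecr xs Bool.≟ true

  NonDecr-tail : ∀ x xs → NonDecr (x ∷ xs) → NonDecr xs
  NonDecr-tail x []       _  = refl
  NonDecr-tail x (y ∷ ys) nd with toℕ x ℕ.≤ᵇ toℕ y
  ... | true = nd

  NonDecr-head : ∀ x y ys → NonDecr (x ∷ y ∷ ys) → toℕ x ≤ toℕ y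
  NonDecr-head x y ys nd with toℕ x ℕ.≤ᵇ toℕ y in x≤ᵇy
  ... | true = ℕ.≤ᵇ⇒≤ (toℕ x) (toℕ y) (Equivalence.from Bool.T-≡ x≤ᵇy)

  NonDecr-head-≤-all : ∀ x xs → NonDecr (x ∷ xs) → All (λ y → toℕ x ≤ toℕ y) xs
  NonDecr-head-≤-all x []       _  = []
  NonDecr-head-≤-all x (y ∷ ys) nd =
    x≤y ∷ All.map (ℕ.≤-trans x≤y) (NonDecr-head-≤-all y ys (NonDecr-tail x (y ∷ ys) nd))
    where
    x≤y : toℕ x ≤ toℕ y
    x≤y = NonDecr-head x y ys nd

  NonDecr-∷ : ∀ x xs → All (λ y → toℕ x ≤ toℕ y) xs → NonDecr xs → NonDecr (x ∷ xs)
  NonDecr-∷ x []       _         _  = refl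
  NonDecr-∷ x (y ∷ ys) (x≤y ∷ _) nd rewrite Equivalence.to Bool.T-≡ (ℕ.≤⇒≤ᵇ x≤y) = nd

foldr-⊔-lub : ∀ (ns : List ℕ) {b} → All (_≤ b) ns → foldr _⊔_ 0 ns ≤ b
foldr-⊔-lub []       []          = z≤n
foldr-⊔-lub (n ∷ ns) (n≤b ∷ ns≤b) = ℕ.⊔-lub n≤b (foldr-⊔-lub ns ns≤b)

foldr-⊔-upper : ∀ {ns : List ℕ} {n} → n ∈ ns → n ≤ foldr _⊔_ 0 ns
foldr-⊔-upper {n ∷ ns} (here refl) = ℕ.m≤m⊔n n _
foldr-⊔-upper {n′ ∷ ns} (there n∈) = ℕ.≤-trans (foldr-⊔-upper n∈) (ℕ.m≤n⊔m n′ _)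

module _ {m l : ℕ} (s : Word m l) where

  length≤Lnd : ∀ {xs} → xs ∈ subseqs (toList s) → NonDecr xs → length xs ≤ Lnd s
  length≤Lnd xs∈ nd = foldr-⊔-upper (∈-map⁺ length (∈-filter⁺ nonDecr? xs∈ nd))

  Lnd-lub : ∀ {b} → (∀ {xs} → xs ∈ subseqs (toList s) → NonDecr xs → length xs ≤ b) → Lnd s ≤ b
  Lnd-lub {b} bound = foldr-⊔-lub _ (All.tabulate λ n∈ → bounded (∈-map⁻ length n∈))
    where
    bounded : ∀ {n} → ∃ (λ xs → xs ∈ filter nonDecr? (subseqs (toList s)) × n ≡ length xs) → n ≤ b
    bounded (xs , xs∈ , refl) with ∈-filter⁻ nonDecr? {xs = subseqs (toList s)} xs∈
    ... | xs∈′ , nd = bound xs∈′ nd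

countBy-subseqs : ∀ {P : X → Set} (P? : Decidable P) l {xs} → xs ∈ subseqs l → countBy P? xs ≤ countBy P? l
countBy-subseqs P? []      (here refl) = ℕ.≤-refl
countBy-subseqs P? (x ∷ l) xs∈ with ∈-++⁻ (map (x ∷_) (subseqs l)) xs∈
... | inj₂ xs∈l = ℕ.≤-trans (countBy-subseqs P? l xs∈l)
                            (ℕ.≤-trans (ℕ.m≤n+m _ _) (ℕ.≤-reflexive (sym (countBy-∷ P? x l))))
... | inj₁ x∷ys∈ with ∈-map⁻ (x ∷_) x∷ys∈
...   | ys , ys∈l , refl = begin
  countBy P? (x ∷ ys)              ≡⟨ countBy-∷ P? x ys ⟩
  indicator (P? x) + countBy P? ys ≤⟨ ℕ.+-monoʳ-≤ (indicator (P? x)) (countBy-subseqs P? l ys∈l) ⟩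
  indicator (P? x) + countBy P? l  ≡⟨ countBy-∷ P? x l ⟨
  countBy P? (x ∷ l)               ∎
  where open ℕ.≤-Reasoning

module _ (h : X → Maybe Y) where

  dropped? : Decidable (λ x → h x ≡ nothing)
  dropped? x with h x
  ... | nothing = yes refl
  ... | just _  = no λ ()

  length-mapMaybe-+-dropped : ∀ xs → length xs ≡ length (mapMaybe h xs) + countBy dropped? xs
  length-mapMaybe-+-dropped []       = refl
  length-mapMaybe-+-dropped (x ∷ xs) with h x | length-mapMaybe-+-dropped xs
  ... | nothing | eq = trans (cong suc eq) (sym (ℕ.+-suc _ _))
  ... | just _  | eq = cong suc eq

  mapMaybe-∈-subseqs : ∀ l {xs} → xs ∈ subseqs l → mapMaybe h xs ∈ subseqs (mapMaybe h l)
  mapMaybe-∈-subseqs []      (here refl) = here refl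
  mapMaybe-∈-subseqs (x ∷ l) {xs} xs∈ with ∈-++⁻ (map (x ∷_) (subseqs l)) xs∈
  ... | inj₂ xs∈l = skip (h x)
    where
    skip : ∀ r → mapMaybe h xs ∈ subseqs (maybe′ _∷_ id r (mapMaybe h l))
    skip nothing  = mapMaybe-∈-subseqs l xs∈l
    skip (just a) = ∈-++⁺ʳ (map (a ∷_) (subseqs (mapMaybe h l))) (mapMaybe-∈-subseqs l xs∈l)
  ... | inj₁ x∷ys∈ with ∈-map⁻ (x ∷_) x∷ys∈
  ...   | ys , ys∈l , refl = keep (h x)
    where
    keep : ∀ r → maybe′ _∷_ id r (mapMaybe h ys) ∈ subseqs (maybe′ _∷_ id r (mapMaybe h l))
    keep nothing  = mapMaybe-∈-subseqs l ys∈l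
    keep (just a) = ∈-++⁺ˡ (∈-map⁺ (a ∷_) (mapMaybe-∈-subseqs l ys∈l))

module _ {m m′ : ℕ} (h : Fin m → Maybe (Fin m′))
         (monotone : ∀ {x y a b} → h x ≡ just a → h y ≡ just b → toℕ x ≤ toℕ y → toℕ a ≤ toℕ b) where

  mapMaybe-≥-all : ∀ {x a} xs → h x ≡ just a →
                   All (λ y → toℕ x ≤ toℕ y) xs → All (λ b → toℕ a ≤ toℕ b) (mapMaybe h xs)
  mapMaybe-≥-all []       _    _            = []
  mapMaybe-≥-all (y ∷ ys) hx≡a (x≤y ∷ x≤ys) with h y in hy≡b
  ... | nothing = mapMaybe-≥-all ys hx≡a x≤ys
  ... | just b  = monotone hx≡a hy≡b x≤y ∷ mapMaybe-≥-all ys hx≡a x≤ys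

  NonDecr-mapMaybe : ∀ xs → NonDecr xs → NonDecr (mapMaybe h xs)
  NonDecr-mapMaybe []       _  = refl
  NonDecr-mapMaybe (x ∷ xs) nd with h x in hx≡a
  ... | nothing = NonDecr-mapMaybe xs (NonDecr-tail x xs nd)
  ... | just a  = NonDecr-∷ a (mapMaybe h xs) (mapMaybe-≥-all xs hx≡a (NonDecr-head-≤-all x xs nd))
                            (NonDecr-mapMaybe xs (NonDecr-tail x xs nd))

  Lnd-≤-Lnd-mapMaybe-+-dropped : ∀ {l l′} (s : Word m l) (t : Word m′ l′) → toList t ≡ mapMaybe h (toList s) →
                                 Lnd s ≤ Lnd t + countBy (dropped? h) (toList s)
  Lnd-≤-Lnd-mapMaybe-+-dropped s t t≡hs = Lnd-lub s bound
    where
    open ℕ.≤-Reasoning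
    bound : ∀ {xs} → xs ∈ subseqs (toList s) → NonDecr xs → length xs ≤ Lnd t + countBy (dropped? h) (toList s)
    bound {xs} xs∈ nd = begin
      length xs                                         ≡⟨ length-mapMaybe-+-dropped h xs ⟩
      length (mapMaybe h xs) + countBy (dropped? h) xs  ≤⟨ ℕ.+-mono-≤ (length≤Lnd t image∈ (NonDecr-mapMaybe xs nd))
                                                                      (countBy-subseqs (dropped? h) (toList s) xs∈) ⟩
      Lnd t + countBy (dropped? h) (toList s)           ∎
      where
      image∈ : mapMaybe h xs ∈ subseqs (toList t)
      image∈ = subst (λ u → mapMaybe h xs ∈ subseqs u) (sym t≡hs) (mapMaybe-∈-subseqs h (toList s) xs∈)

swapAdjacent : ℕ → List Z → List Z
swapAdjacent zero    (a ∷ b ∷ u) = b ∷ a ∷ u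
swapAdjacent (suc i) (a ∷ u)     = a ∷ swapAdjacent i u
swapAdjacent _       u           = u

swapAdjacent-involutive : ∀ i (u : List Z) → swapAdjacent i (swapAdjacent i u) ≡ u
swapAdjacent-involutive zero    []          = refl
swapAdjacent-involutive zero    (a ∷ [])    = refl
swapAdjacent-involutive zero    (a ∷ b ∷ u) = refl
swapAdjacent-involutive (suc i) []          = refl
swapAdjacent-involutive (suc i) (a ∷ u)     = cong (a ∷_) (swapAdjacent-involutive i u)

swapAdjacent-++ : ∀ (p : List Z) a b u → swapAdjacent (length p) (p ++ a ∷ b ∷ u) ≡ p ++ b ∷ a ∷ u
swapAdjacent-++ []      a b u = refl
swapAdjacent-++ (c ∷ p) a b u = cong (c ∷_) (swapAdjacent-++ p a b u)

↭-invariant : (f : List Z → C) → (∀ i u → f (swapAdjacent i u) ≡ f u) → ∀ {u v} → u ↭ v → f u ≡ f v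
↭-invariant f swap-invariant = after []
  where
  -- Generalised over a prefix p, so that a swap inside the permutation is swapAdjacent (length p).
  after : ∀ p {u v} → u ↭ v → f (p ++ u) ≡ f (p ++ v)

  after-++ : ∀ p q {u v} → u ↭ v → f (p ++ q ++ u) ≡ f (p ++ q ++ v)
  after-++ p q {u} {v} u↭v =
    subst₂ (λ u′ v′ → f u′ ≡ f v′) (List.++-assoc p q u) (List.++-assoc p q v) (after (p ++ q) u↭v)

  after p ↭.refl                              = refl
  after p (↭.prep a u↭v)                      = after-++ p [ a ] u↭v
  after p (↭.trans u↭w w↭v)                   = trans (after p u↭w) (after p w↭v)
  after p (↭.swap {xs = u} {ys = v} a b u↭v) = begin
    f (p ++ a ∷ b ∷ u)                           ≡⟨ swap-invariant (length p) (p ++ a ∷ b ∷ u) ⟨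
    f (swapAdjacent (length p) (p ++ a ∷ b ∷ u)) ≡⟨ cong f (swapAdjacent-++ p a b u) ⟩
    f (p ++ b ∷ a ∷ u)                           ≡⟨ after-++ p (b ∷ [ a ]) u↭v ⟩
    f (p ++ b ∷ a ∷ v)                           ∎
    where open ≡-Reasoning

map-involution-↭ : ∀ {f : Z → Z} {zs} → Unique zs → (∀ z → f (f z) ≡ z) → (∀ {z} → z ∈ zs → f z ∈ zs) →
                   map f zs ↭ zs
map-involution-↭ {f = f} {zs} unique involutive closed =
  ∼bag⇒↭ (unique∧set⇒bag (Unique.map⁺ injective unique) unique (mk⇔ to from))
  where
  injective : ∀ {x y} → f x ≡ f y → x ≡ y
  injective {x} {y} fx≡fy = trans (sym (involutive x)) (trans (cong f fx≡fy) (involutive y))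
  to : ∀ {z} → z ∈ map f zs → z ∈ zs
  to z∈ with ∈-map⁻ f z∈
  ... | _ , z′∈ , refl = closed z′∈
  from : ∀ {z} → z ∈ zs → z ∈ map f zs
  from {z} z∈ = subst (_∈ map f zs) (involutive z) (∈-map⁺ f (closed z∈))

-- A letter x is visible if h x ≢ nothing; swapVisible i exchanges the i-th and (i+1)-th visible
-- letters of a word, leaving the invisible ones in place.
module _ (h : X → Maybe Y) where

  mutual
    replaceFirstVisible : ∀ {l} → X → Vec X l → Maybe (X × Vec X l)
    replaceFirstVisible y Vec.[]      = nothing
    replaceFirstVisible y (z Vec.∷ s) = replaceFirstVisible-∷ y z (h z) s

    replaceFirstVisible-∷ : ∀ {l} → X → X → Maybe Y → Vec X l → Maybe (X × Vec X (suc l))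
    replaceFirstVisible-∷ y z (just _) s = just (z , y Vec.∷ s)
    replaceFirstVisible-∷ y z nothing  s = Maybe.map (map₂ (z Vec.∷_)) (replaceFirstVisible y s)

  replaceFirstVisible-↭ : ∀ {l y z} (s : Vec X l) {s′} → replaceFirstVisible y s ≡ just (z , s′) →
                          y ∷ toList s ↭ z ∷ toList s′
  replaceFirstVisible-↭ {y = y} (w Vec.∷ s) eq with h w
  replaceFirstVisible-↭ {y = y} (w Vec.∷ s) refl | just _ = swap y w ↭-refl
  ... | nothing with replaceFirstVisible y s in found
  replaceFirstVisible-↭ {y = y} (w Vec.∷ s) refl | nothing | just (z , s′) =
    ↭-trans (swap y w ↭-refl) (↭-trans (prep w (replaceFirstVisible-↭ s found)) (swap w z ↭-refl))

  replaceFirstVisible-mapMaybe : ∀ {l y z a} (s : Vec X l) {s′} → h y ≡ just a → replaceFirstVisible y s ≡ just (z , s′) →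
                                 ∃ λ b → ∃ λ u → h z ≡ just b ×
                                   mapMaybe h (toList s) ≡ b ∷ u × mapMaybe h (toList s′) ≡ a ∷ u
  replaceFirstVisible-mapMaybe (w Vec.∷ s) hy≡a eq with h w in hw
  replaceFirstVisible-mapMaybe (w Vec.∷ s) hy≡a refl | just b =
    b , mapMaybe h (toList s) , hw , refl , cong (λ r → maybe′ _∷_ id r (mapMaybe h (toList s))) hy≡a
  replaceFirstVisible-mapMaybe {y = y} (w Vec.∷ s) hy≡a eq | nothing with replaceFirstVisible y s in found
  replaceFirstVisible-mapMaybe (w Vec.∷ s) hy≡a refl | nothing | just (z , s′)
    with replaceFirstVisible-mapMaybe s hy≡a found
  ... | b , u , hz≡b , hs≡bu , hs′≡au =
    b , u , hz≡b , hs≡bu , trans (cong (λ r → maybe′ _∷_ id r (mapMaybe h (toList s′))) hw) hs′≡au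

  replaceFirstVisible-involutive : ∀ {l y z a} (s : Vec X l) {s′} → h y ≡ just a → replaceFirstVisible y s ≡ just (z , s′) →
                                   replaceFirstVisible z s′ ≡ just (y , s)
  replaceFirstVisible-involutive (w Vec.∷ s) hy≡a eq with h w in hw
  replaceFirstVisible-involutive (w Vec.∷ s) hy≡a refl | just _ rewrite hy≡a = refl
  replaceFirstVisible-involutive {y = y} (w Vec.∷ s) hy≡a eq | nothing with replaceFirstVisible y s in found
  replaceFirstVisible-involutive (w Vec.∷ s) hy≡a refl | nothing | just (z , s′)
    rewrite hw | replaceFirstVisible-involutive s hy≡a found = refl

  replaceFirstVisible-nothing : ∀ {l y} (s : Vec X l) → replaceFirstVisible y s ≡ nothing → mapMaybe h (toList s) ≡ []
  replaceFirstVisible-nothing Vec.[] _ = refl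
  replaceFirstVisible-nothing (w Vec.∷ s) eq with h w
  replaceFirstVisible-nothing (w Vec.∷ s) () | just _
  replaceFirstVisible-nothing {y = y} (w Vec.∷ s) eq | nothing with replaceFirstVisible y s in none
  replaceFirstVisible-nothing (w Vec.∷ s) refl | nothing | nothing = replaceFirstVisible-nothing s none

  mutual
    swapVisible : ∀ {l} → ℕ → Vec X l → Vec X l
    swapVisible i Vec.[]      = Vec.[]
    swapVisible i (x Vec.∷ s) = swapVisible-∷ i x (h x) s

    swapVisible-∷ : ∀ {l} → ℕ → X → Maybe Y → Vec X l → Vec X (suc l)
    swapVisible-∷ i       x nothing  s = x Vec.∷ swapVisible i s
    swapVisible-∷ (suc i) x (just _) s = x Vec.∷ swapVisible i s
    swapVisible-∷ zero    x (just _) s = maybe′ (uncurry Vec._∷_) (x Vec.∷ s) (replaceFirstVisible x s)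

  swapVisible-↭ : ∀ {l} i (s : Vec X l) → toList (swapVisible i s) ↭ toList s
  swapVisible-∷-↭ : ∀ {l} i x r (s : Vec X l) → toList (swapVisible-∷ i x r s) ↭ x ∷ toList s
  swapVisible-↭ i Vec.[]      = ↭-refl
  swapVisible-↭ i (x Vec.∷ s) = swapVisible-∷-↭ i x (h x) s
  swapVisible-∷-↭ i       x nothing  s = prep x (swapVisible-↭ i s)
  swapVisible-∷-↭ (suc i) x (just _) s = prep x (swapVisible-↭ i s)
  swapVisible-∷-↭ zero    x (just _) s with replaceFirstVisible x s in found
  ... | nothing       = ↭-refl
  ... | just (z , s′) = ↭-sym (replaceFirstVisible-↭ s found)

  swapVisible-involutive : ∀ {l} i (s : Vec X l) → swapVisible i (swapVisible i s) ≡ s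
  swapVisible-∷-involutive : ∀ {l} i x r (s : Vec X l) → h x ≡ r → swapVisible i (swapVisible-∷ i x r s) ≡ x Vec.∷ s
  swapVisible-involutive i Vec.[]      = refl
  swapVisible-involutive i (x Vec.∷ s) = swapVisible-∷-involutive i x (h x) s refl
  swapVisible-∷-involutive i       x nothing  s hx rewrite hx = cong (x Vec.∷_) (swapVisible-involutive i s)
  swapVisible-∷-involutive (suc i) x (just _) s hx rewrite hx = cong (x Vec.∷_) (swapVisible-involutive i s)
  swapVisible-∷-involutive zero    x (just a) s hx with replaceFirstVisible x s in found
  ... | nothing rewrite hx | found = refl
  ... | just (z , s′) with replaceFirstVisible-mapMaybe s hx found
  ...   | _ , _ , hz≡b , _ rewrite hz≡b | replaceFirstVisible-involutive s hx found = refl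

  mapMaybe-swapVisible : ∀ {l} i (s : Vec X l) → mapMaybe h (toList (swapVisible i s)) ≡ swapAdjacent i (mapMaybe h (toList s))
  mapMaybe-swapVisible-∷ : ∀ {l} i x r (s : Vec X l) → h x ≡ r →
                           mapMaybe h (toList (swapVisible-∷ i x r s)) ≡ swapAdjacent i (mapMaybe h (x ∷ toList s))
  mapMaybe-swapVisible zero    Vec.[]      = refl
  mapMaybe-swapVisible (suc i) Vec.[]      = refl
  mapMaybe-swapVisible i       (x Vec.∷ s) = mapMaybe-swapVisible-∷ i x (h x) s refl
  mapMaybe-swapVisible-∷ i       x nothing  s hx rewrite hx = mapMaybe-swapVisible i s
  mapMaybe-swapVisible-∷ (suc i) x (just a) s hx rewrite hx = cong (a ∷_) (mapMaybe-swapVisible i s)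
  mapMaybe-swapVisible-∷ zero    x (just a) s hx with replaceFirstVisible x s in found
  ... | nothing rewrite hx | replaceFirstVisible-nothing s found = refl
  ... | just (z , s′) with replaceFirstVisible-mapMaybe s hx found
  ...   | _ , _ , hz≡b , hs≡bu , hs′≡au rewrite hx | hz≡b | hs≡bu | hs′≡au = refl

module _ (h : X → Maybe Y) (_≟_ : DecidableEquality Y) {l} {S : List (Vec X l)} (S-unique : Unique S)
         (S-closed : ∀ {s s′} → s ∈ S → toList s ↭ toList s′ → s′ ∈ S) where

  preimageCount : List Y → ℕ
  preimageCount u = countBy (λ s → List.≡-dec _≟_ u (mapMaybe h (toList s))) S

  preimageCount-swapAdjacent : ∀ i u → preimageCount (swapAdjacent i u) ≡ preimageCount u
  preimageCount-swapAdjacent i u = begin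
    countBy (λ s → swapAdjacent i u ≟ᴸ image s) S          ≡⟨ countBy-↭ _ (map-involution-↭ S-unique σσ σ∈) ⟨
    countBy (λ s → swapAdjacent i u ≟ᴸ image s) (map σ S)  ≡⟨ countBy-map _ σ S ⟩
    countBy (λ s → swapAdjacent i u ≟ᴸ image (σ s)) S
      ≡⟨ countBy-cong _ (λ s → u ≟ᴸ image s) {S} (λ {s} _ → to {s}) (λ {s} _ → from {s}) ⟩
    countBy (λ s → u ≟ᴸ image s) S                         ∎
    where
    open ≡-Reasoning
    _≟ᴸ_ : DecidableEquality (List Y)
    _≟ᴸ_ = List.≡-dec _≟_
    image : Vec X l → List Y
    image s = mapMaybe h (toList s)
    σ : Vec X l → Vec X l
    σ = swapVisible h i
    σσ : ∀ s → σ (σ s) ≡ s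
    σσ = swapVisible-involutive h i
    σ∈ : ∀ {s} → s ∈ S → σ s ∈ S
    σ∈ {s} s∈ = S-closed s∈ (↭-sym (swapVisible-↭ h i s))
    to : ∀ {s} → swapAdjacent i u ≡ image (σ s) → u ≡ image s
    to {s} eq = trans (sym (swapAdjacent-involutive i u))
                      (trans (cong (swapAdjacent i) (trans eq (mapMaybe-swapVisible h i s))) (swapAdjacent-involutive i _))
    from : ∀ {s} → u ≡ image s → swapAdjacent i u ≡ image (σ s)
    from {s} eq = trans (cong (swapAdjacent i) eq) (sym (mapMaybe-swapVisible h i s))

  preimageCount-↭ : ∀ {u v} → u ↭ v → preimageCount u ≡ preimageCount v
  preimageCount-↭ = ↭-invariant preimageCount preimageCount-swapAdjacent

module _ {P : ℕ → Set} (P? : Decidable P) where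

  countBy-upTo-suc : ∀ N → countBy P? (upTo (suc N)) ≡ countBy P? (upTo N) + countBy P? [ N ]
  countBy-upTo-suc N = trans (cong (countBy P?) (sym (List.upTo-∷ʳ N))) (countBy-++ P? (upTo N) [ N ])

  countBy-upTo-accept : ∀ {N} → P N → countBy P? (upTo (suc N)) ≡ suc (countBy P? (upTo N))
  countBy-upTo-accept {N} pN = begin
    countBy P? (upTo (suc N))               ≡⟨ countBy-upTo-suc N ⟩
    countBy P? (upTo N) + countBy P? [ N ]  ≡⟨ cong (λ c → countBy P? (upTo N) + length c) (List.filter-accept P? pN) ⟩
    countBy P? (upTo N) + 1                 ≡⟨ ℕ.+-comm _ 1 ⟩
    suc (countBy P? (upTo N))               ∎
    where open ≡-Reasoning

  countBy-upTo-reject : ∀ {N} → ¬ P N → countBy P? (upTo (suc N)) ≡ countBy P? (upTo N)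
  countBy-upTo-reject {N} ¬pN = begin
    countBy P? (upTo (suc N))               ≡⟨ countBy-upTo-suc N ⟩
    countBy P? (upTo N) + countBy P? [ N ]  ≡⟨ cong (λ c → countBy P? (upTo N) + length c) (List.filter-reject P? ¬pN) ⟩
    countBy P? (upTo N) + 0                 ≡⟨ ℕ.+-identityʳ _ ⟩
    countBy P? (upTo N)                     ∎
    where open ≡-Reasoning

module _ (A : ℕ) .{{_ : NonZero A}} (J : ℕ) where

  inBlock? : Decidable (λ m → m / A ≡ J)
  inBlock? m = m / A ℕ.≟ J

  /≡-intro : ∀ {m} → J * A ≤ m → m < J * A + A → m / A ≡ J
  /≡-intro {m} lo hi = ℕ.≤-antisym
    (ℕ.<⇒≤pred (m<n*o⇒m/o<n (subst (m <_) (ℕ.+-comm (J * A) A) hi)))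
    (subst (_≤ m / A) (m*n/n≡m J A) (/-monoˡ-≤ A lo))

  /≢-below : ∀ {m} → m < J * A → m / A ≢ J
  /≢-below lt eq = ℕ.<-irrefl eq (m<n*o⇒m/o<n lt)

  /≢-above : ∀ {m} → J * A + A ≤ m → m / A ≢ J
  /≢-above {m} le eq = ℕ.<-irrefl (sym eq)
    (subst (_≤ m / A) (m*n/n≡m (suc J) A) (/-monoˡ-≤ A (subst (_≤ m) (ℕ.+-comm (J * A) A) le)))

  countBy-inBlock-below : ∀ N → N ≤ J * A → countBy inBlock? (upTo N) ≡ 0
  countBy-inBlock-below zero    _  = refl
  countBy-inBlock-below (suc N) le =
    trans (countBy-upTo-reject inBlock? (/≢-below le)) (countBy-inBlock-below N (ℕ.<⇒≤ le))

  countBy-inBlock-within : ∀ r → r ≤ A → countBy inBlock? (upTo (J * A + r)) ≡ r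
  countBy-inBlock-within zero    _  = subst (λ N → countBy inBlock? (upTo N) ≡ 0) (sym (ℕ.+-identityʳ (J * A)))
                                       (countBy-inBlock-below (J * A) ℕ.≤-refl)
  countBy-inBlock-within (suc r) le rewrite ℕ.+-suc (J * A) r =
    trans (countBy-upTo-accept inBlock? (/≡-intro (ℕ.m≤m+n (J * A) r) (ℕ.+-monoʳ-< (J * A) le)))
          (cong suc (countBy-inBlock-within r (ℕ.<⇒≤ le)))

  countBy-inBlock-above : ∀ d → countBy inBlock? (upTo (J * A + A + d)) ≡ A
  countBy-inBlock-above zero    rewrite ℕ.+-identityʳ (J * A + A) = countBy-inBlock-within A ℕ.≤-refl
  countBy-inBlock-above (suc d) rewrite ℕ.+-suc (J * A + A) d =
    trans (countBy-upTo-reject inBlock? (/≢-above (ℕ.m≤m+n (J * A + A) d))) (countBy-inBlock-above d)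

  countBy-inBlock : ∀ N → J * A + A ≤ N → countBy inBlock? (upTo N) ≡ A
  countBy-inBlock N le =
    subst (λ N → countBy inBlock? (upTo N) ≡ A) (ℕ.m+[n∸m]≡n le) (countBy-inBlock-above (N ∸ (J * A + A)))

tabulate-∘toℕ : ∀ n (f : ℕ → X) → List.tabulate {n = n} (f ∘ toℕ) ≡ List.applyUpTo f n
tabulate-∘toℕ zero    f = refl
tabulate-∘toℕ (suc n) f = cong (f 0 ∷_) (tabulate-∘toℕ n (f ∘ suc))

map-toℕ-allFin : ∀ n → map toℕ (allFin n) ≡ upTo n
map-toℕ-allFin n = trans (List.map-tabulate id toℕ) (tabulate-∘toℕ n id)

module _ (A n : ℕ) .{{_ : NonZero A}} where

  blockOf : Fin n → Maybe (Fin (n / A))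
  blockOf x with toℕ x / A ℕ.<? n / A
  ... | yes lt = just (fromℕ< lt)
  ... | no _   = nothing

  blockOf≡just⇒ : ∀ {x j} → blockOf x ≡ just j → toℕ j ≡ toℕ x / A
  blockOf≡just⇒ {x} eq with toℕ x / A ℕ.<? n / A
  blockOf≡just⇒ refl | yes lt = Fin.toℕ-fromℕ< lt

  blockOf≡just⇐ : ∀ {x j} → toℕ x / A ≡ toℕ j → blockOf x ≡ just j
  blockOf≡just⇐ {x} {j} eq with toℕ x / A ℕ.<? n / A
  ... | yes lt = cong just (Fin.toℕ-injective (trans (Fin.toℕ-fromℕ< lt) eq))
  ... | no ¬lt = contradiction (subst (_< n / A) (sym eq) (Fin.toℕ<n j)) ¬lt

  blockOf-monotone : ∀ {x y a b} → blockOf x ≡ just a → blockOf y ≡ just b → toℕ x ≤ toℕ y → toℕ a ≤ toℕ b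
  blockOf-monotone x↦a y↦b x≤y rewrite blockOf≡just⇒ x↦a | blockOf≡just⇒ y↦b = /-monoˡ-≤ A x≤y

  countBy-blockOf : ∀ j → countBy (λ x → Maybe.≡-dec Fin._≟_ (blockOf x) (just j)) (allFin n) ≡ A
  countBy-blockOf j = begin
    countBy (λ x → Maybe.≡-dec Fin._≟_ (blockOf x) (just j)) (allFin n)
      ≡⟨ countBy-cong (λ x → Maybe.≡-dec Fin._≟_ (blockOf x) (just j)) (inBlock? A (toℕ j) ∘ toℕ) {allFin n}
                      (λ _ → sym ∘ blockOf≡just⇒) (λ _ → blockOf≡just⇐) ⟩
    countBy (inBlock? A (toℕ j) ∘ toℕ) (allFin n)          ≡⟨ countBy-map (inBlock? A (toℕ j)) toℕ (allFin n) ⟨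
    countBy (inBlock? A (toℕ j)) (map toℕ (allFin n))      ≡⟨ cong (countBy (inBlock? A (toℕ j))) (map-toℕ-allFin n) ⟩
    countBy (inBlock? A (toℕ j)) (upTo n)                  ≡⟨ countBy-inBlock A (toℕ j) n block-fits ⟩
    A                                                      ∎
    where
    open ≡-Reasoning
    block-fits : toℕ j * A + A ≤ n
    block-fits = ℕ.≤-trans (ℕ.≤-reflexive (ℕ.+-comm (toℕ j * A) A))
                           (ℕ.≤-trans (ℕ.*-monoˡ-≤ A (Fin.toℕ<n j)) (m/n*n≤m n A))

count-mapMaybe : ∀ {m} (h : X → Maybe (Fin m)) j xs →
                 count j (mapMaybe h xs) ≡ countBy (λ x → Maybe.≡-dec Fin._≟_ (h x) (just j)) xs
count-mapMaybe h j []       = refl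
count-mapMaybe h j (x ∷ xs) with h x
... | nothing = count-mapMaybe h j xs
... | just a with a Fin.≟ j
...   | yes refl = cong suc (count-mapMaybe h j xs)
...   | no a≢j   = count-mapMaybe h j xs

module _ (n k A : ℕ) .{{_ : NonZero A}} where

  private
    q : ℕ
    q = n / A
    h : Fin n → Maybe (Fin q)
    h = blockOf A n
    Perms : List (Word n (k * n))
    Perms = multisetPerms k n
    BlockPerms : List (Word q (k * A * q))
    BlockPerms = multisetPerms (k * A) q

  IsBlockImage : Word n (k * n) → Word q (k * A * q) → Set
  IsBlockImage s t = toList t ≡ mapMaybe h (toList s)

  isBlockImage? : ∀ s t → Dec (IsBlockImage s t)
  isBlockImage? s t = List.≡-dec Fin._≟_ (toList t) (mapMaybe h (toList s))

  module _ {s} (s∈ : s ∈ Perms) where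

    count-blockImage : ∀ j → count j (mapMaybe h (toList s)) ≡ k * A
    count-blockImage j = begin
      count j (mapMaybe h (toList s))                                    ≡⟨ count-mapMaybe h j (toList s) ⟩
      countBy (λ x → Maybe.≡-dec Fin._≟_ (h x) (just j)) (toList s)      ≡⟨ countBy-multisetPerm k n _ s∈ ⟩
      k * countBy (λ x → Maybe.≡-dec Fin._≟_ (h x) (just j)) (allFin n)  ≡⟨ cong (k *_) (countBy-blockOf A n j) ⟩
      k * A                                                              ∎
      where open ≡-Reasoning

    length-blockImage : length (mapMaybe h (toList s)) ≡ k * A * q
    length-blockImage = begin
      length (mapMaybe h (toList s))                                ≡⟨ length≡sum-count (mapMaybe h (toList s)) ⟩
      sum (map (λ j → count j (mapMaybe h (toList s))) (allFin q))  ≡⟨ sum-map-const _ (k * A) {allFin q} (λ {j} _ → count-blockImage j) ⟩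
      length (allFin q) * (k * A)                                   ≡⟨ cong (_* (k * A)) (List.length-tabulate {n = q} id) ⟩
      q * (k * A)                                                   ≡⟨ ℕ.*-comm q (k * A) ⟩
      k * A * q                                                     ∎
      where open ≡-Reasoning

    countBy-isBlockImage≡1 : countBy (isBlockImage? s) BlockPerms ≡ 1
    countBy-isBlockImage≡1 with ∃-Vec-toList (mapMaybe h (toList s)) length-blockImage
    ... | t , s↦t = countBy-unique (isBlockImage? s) (multisetPerms-unique {k * A} {q}) t∈ s↦t (λ _ → image-unique)
      where
      image-unique : ∀ {t′} → IsBlockImage s t′ → t′ ≡ t
      image-unique {t′} s↦t′ = trans (sym (Vec.cast-is-id refl t′)) (Vec.toList-injective refl t′ t (trans s↦t′ (sym s↦t)))
      t∈ : t ∈ BlockPerms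
      t∈ = ∈-multisetPerms⁺ λ j → trans (cong (count j) s↦t) (count-blockImage j)

    countBy-dropped≤k*A : countBy (dropped? h) (toList s) ≤ k * A
    countBy-dropped≤k*A = ℕ.+-cancelˡ-≤ (k * A * q) _ _ (begin
      k * A * q + countBy (dropped? h) (toList s)                       ≡⟨ cong (_+ countBy (dropped? h) (toList s)) length-blockImage ⟨
      length (mapMaybe h (toList s)) + countBy (dropped? h) (toList s)  ≡⟨ length-mapMaybe-+-dropped h (toList s) ⟨
      length (toList s)                                                 ≡⟨ Vec.length-toList s ⟩
      k * n                                                             ≤⟨ ℕ.*-monoʳ-≤ k n≤qA+A ⟩
      k * (q * A + A)                                                   ≡⟨ ℕ.*-distribˡ-+ k (q * A) A ⟩
      k * (q * A) + k * A                                               ≡⟨ cong (_+ k * A) k*[q*A]≡k*A*q ⟩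
      k * A * q + k * A                                                 ∎)
      where
      open ℕ.≤-Reasoning
      n≤qA+A : n ≤ q * A + A
      n≤qA+A = begin
        n               ≡⟨ m≡m%n+[m/n]*n n A ⟩
        n % A + q * A   ≡⟨ ℕ.+-comm (n % A) (q * A) ⟩
        q * A + n % A   ≤⟨ ℕ.+-monoʳ-≤ (q * A) (ℕ.<⇒≤ (m%n<n n A)) ⟩
        q * A + A       ∎
      k*[q*A]≡k*A*q : k * (q * A) ≡ k * A * q
      k*[q*A]≡k*A*q = trans (cong (k *_) (ℕ.*-comm q A)) (sym (ℕ.*-assoc k A q))

    Lnd-≤-blockImage : ∀ {t} → IsBlockImage s t → Lnd s ≤ Lnd t + k * A
    Lnd-≤-blockImage {t} s↦t = ℕ.≤-trans (Lnd-≤-Lnd-mapMaybe-+-dropped h (blockOf-monotone A n) s t s↦t)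
                                         (ℕ.+-monoʳ-≤ (Lnd t) countBy-dropped≤k*A)

  fibreSize-isBlockImage-constant : ∀ {t t′} → t ∈ BlockPerms → t′ ∈ BlockPerms →
                                  fibreSize isBlockImage? {Perms} {BlockPerms} t ≡ fibreSize isBlockImage? {Perms} {BlockPerms} t′
  fibreSize-isBlockImage-constant t∈ t′∈ =
    preimageCount-↭ h Fin._≟_ {S = Perms} (multisetPerms-unique {k} {n}) (multisetPerms-closed-↭ {k} {n})
      (multisetPerms-↭ {k * A} {q} t∈ t′∈)

lemma9 : (n k A : ℕ) → .{{_ : NonZero n}} → .{{_ : NonZero k}} → .{{_ : NonZero A}} →
    UniformCoupling (multisetPerms k n) (multisetPerms (k * A) (n / A))
      (λ s t → Lnd s ≤ Lnd t + k * A)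
lemma9 n k A = uniformCoupling-fromGraph (isBlockImage? n k A) (multisetPerms-nonempty k n)
  (countBy-isBlockImage≡1 n k A) (fibreSize-isBlockImage-constant n k A) (λ s∈ → Lnd-≤-blockImage n k A s∈)
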